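{- Let $G$ and $H$ be graphs, each with constant threshold $t\ge 3$, and let $D_H$ be a minimum $t$-dynamic monopoly of $H$. If the induced subgraph $H[D_H]$ is isomorphic to the star $K_{1,dyn_t(H)-1}$, then $dyn_t(G\Box H)\le dyn_t(G)\,dyn_t(H)-dyn_t(H)$.
   Context: $G\Box H$ is the Cartesian product (vertex set $V(G)\times V(H)$, $(u,v)\sim(u',v')$ iff $u=u'$ and $vv'\in E(H)$, or $v=v'$ and $uu'\in E(G)$), with constant threshold $t$. Thresholds are assumed not to exceed vertex degrees. A set $D$ of vertices is a $t$-dynamic monopoly if starting from $D$ and repeatedly adding any vertex having at least $t$ neighbors in the current set eventually yields all vertices; $dyn_t$ is the minimum size of a $t$-dynamic monopoly. $H[S]$ is the subgraph induced by $S$. -}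

module Defs where

open import Data.Nat using (ℕ; zero; suc; _*_; _∸_; _≤_)
open import Data.Bool using (Bool; true; false; _∧_; _∨_; not)
open import Data.Fin using (Fin; zero; suc; remQuot; _≟_)
open import Data.Fin.Subset using (Subset; _∈_; ∣_∣)
open import Data.Vec using (tabulate)
open import Data.List using (List; length)
open import Data.List.Relation.Unary.All using (All)
open import Data.List.Relation.Unary.Unique.Propositional using (Unique)
open import Data.Empty using (⊥-elim)
open import Data.Product using (Σ; _×_; _,_)
open import Relation.Binary.PropositionalEquality using (_≡_; refl; sym; cong₂)
open import Relation.Nullary using (yes; no)
open import Data.Bool.Properties using (∧-zeroʳ)
open import Relation.Nullary.Decidable using (⌊_⌋)
open import Function.Definitions using (Injective)

record Graph : Set where
  field
    n     : ℕ
    adj   : Fin n → Fin n → Bool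
    adj-sym : ∀ u v → adj u v ≡ adj v u
    irref : ∀ v → adj v v ≡ false

open Graph public

Adj : (G : Graph) → Fin (n G) → Fin (n G) → Set
Adj G u v = adj G u v ≡ true

nbhd : (G : Graph) → Fin (n G) → Subset (n G)
nbhd G v = tabulate (adj G v)

deg : (G : Graph) → Fin (n G) → ℕ
deg G v = ∣ nbhd G v ∣

data Active (G : Graph) (t : ℕ) (D : Subset (n G)) : Fin (n G) → Set where
  seed : ∀ {v} → v ∈ D → Active G t D v
  step : ∀ {v} (us : List (Fin (n G))) → Unique us → t ≤ length us →
         All (Adj G v) us → All (Active G t D) us → Active G t D v

IsDynMono : (G : Graph) → ℕ → Subset (n G) → Set
IsDynMono G t D = ∀ v → Active G t D v

-- minimum t-dynamic monopoly (so ∣ D ∣ = dyn_t(G))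
IsMinDynMono : (G : Graph) → ℕ → Subset (n G) → Set
IsMinDynMono G t D = IsDynMono G t D × (∀ D′ → IsDynMono G t D′ → ∣ D ∣ ≤ ∣ D′ ∣)

ThresholdOK : Graph → ℕ → Set
ThresholdOK G t = ∀ v → t ≤ deg G v

-- Cartesian product G □ H on Fin (n G * n H), vertex (u , v) encoded via remQuot
□-padj : (G H : Graph) → Fin (n G) × Fin (n H) → Fin (n G) × Fin (n H) → Bool
□-padj G H (u , v) (u′ , v′) =
  (⌊ u ≟ u′ ⌋ ∧ adj H v v′) ∨ (⌊ v ≟ v′ ⌋ ∧ adj G u u′)

□-adj : (G H : Graph) → Fin (n G * n H) → Fin (n G * n H) → Bool
□-adj G H x y = □-padj G H (remQuot (n H) x) (remQuot (n H) y)

private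
  eqb : ∀ {k} → Fin k → Fin k → Bool
  eqb a b = ⌊ a ≟ b ⌋

  eqb-sym : ∀ {k} (a b : Fin k) → eqb a b ≡ eqb b a
  eqb-sym a b with a ≟ b | b ≟ a
  ... | yes _ | yes _ = refl
  ... | no _  | no _  = refl
  ... | yes p | no q  = ⊥-elim (q (sym p))
  ... | no p  | yes q = ⊥-elim (p (sym q))

  eqb-refl : ∀ {k} (a : Fin k) → eqb a a ≡ true
  eqb-refl a with a ≟ a
  ... | yes _ = refl
  ... | no p  = ⊥-elim (p refl)

□-padj-sym : (G H : Graph) → ∀ p q → □-padj G H p q ≡ □-padj G H q p
□-padj-sym G H (u , v) (u′ , v′) =
  cong₂ _∨_ (cong₂ _∧_ (eqb-sym u u′) (adj-sym H v v′))
            (cong₂ _∧_ (eqb-sym v v′) (adj-sym G u u′))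

□-padj-irref : (G H : Graph) → ∀ p → □-padj G H p p ≡ false
□-padj-irref G H (u , v) rewrite eqb-refl u | eqb-refl v | irref H v | irref G u = refl

□-adj-sym : (G H : Graph) → ∀ x y → □-adj G H x y ≡ □-adj G H y x
□-adj-sym G H x y = □-padj-sym G H (remQuot (n H) x) (remQuot (n H) y)

□-adj-irref : (G H : Graph) → ∀ x → □-adj G H x x ≡ false
□-adj-irref G H x = □-padj-irref G H (remQuot (n H) x)

_□_ : Graph → Graph → Graph
G □ H = record { n = n G * n H ; adj = □-adj G H
               ; adj-sym = □-adj-sym G H ; irref = □-adj-irref G H }

starAdj : ∀ {m} → Fin (suc m) → Fin (suc m) → Bool
starAdj zero    zero    = false
starAdj zero    (suc _) = true
starAdj (suc _) zero    = true
starAdj (suc _) (suc _) = false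

InducedIsoStar : (H : Graph) → Subset (n H) → ℕ → Set
InducedIsoStar H D m =
  Σ (Fin (suc m) → Fin (n H)) λ f →
    Injective _≡_ _≡_ f ×
    (∀ i → f i ∈ D) ×
    (∀ v → v ∈ D → Σ (Fin (suc m)) λ i → f i ≡ v) ×
    (∀ i j → adj H (f i) (f j) ≡ starAdj i j)

module Submission where

-- Any dynamo D_G has a vertex w with t neighbours N ⊆ D_G (the first
-- vertex activated outside D_G). For g₁ ∈ D_G and a leaf ℓ₀, seed G □ H with D_G × leaves minus (g₁ , ℓ₀),
-- with (w , c) and with (D_G ∖ N) × {c}: ∣D_G∣(t - 1) + ∣D_G∣ - ∣N∣ ≤ ∣D_G∣ t - t vertices. Each x ∈ N
-- other than g₁ gets (x , c) from (w , c) and its t - 1 leaves; every leaf row other than ℓ₀ is a copy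
-- of G seeded by D_G; in the rows c and ℓ₀ the activation of G is replayed away from g₁, and g₁ follows
-- from its t neighbours. Then every column contains an active copy of D_H.

open import Defs
open import Data.Nat using (ℕ; zero; suc; _*_; _∸_; _≤_; _<_; _+_; z≤n; s≤s; s≤s⁻¹)
open import Data.Nat.Properties
  using ( ≤-trans; ≤-reflexive; ≤-antisym; <⇒≱; ≮⇒≥; +-assoc; +-comm; *-suc; +-mono-≤; +-monoʳ-≤
        ; m+n≤o⇒m≤o∸n; module ≤-Reasoning)
open import Data.Bool using (true; _∧_; _∨_)
open import Data.Fin using (Fin; zero; suc; _≟_; combine; remQuot)
open import Data.Fin.Properties
  using (suc-injective; ¬Fin0; all?; ¬∀⟶∃¬; combine-injective; remQuot-combine; combine-remQuot)
open import Data.Fin.Subset using (Subset; ∣_∣; _∈_; _∉_; ⁅_⁆; _∪_; _-_; ⊥; inside; outside)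
open import Data.Fin.Subset.Properties
  using (∣⊥∣≡0; x∈⁅x⁆; x∈p∪q⁺; ∪-identityˡ; ∣p∣≤∣x∷p∣; x∈p∧x≢y⇒x∈p-y; x∈p⇒∣p-x∣<∣p∣)
  renaming (_∈?_ to _∈ₛ?_)
open import Data.Vec using ([]; _∷_; here; there; tabulate)
open import Data.Vec.Properties using ([]=⇒lookup; lookup∘tabulate)
open import Data.List using (List; []; _∷_; map; length; filter; foldr; cartesianProductWith; _++_)
open import Data.List.Properties using (length-map; length-++; filter-all; filter-notAll)
open import Data.List.Relation.Unary.All as All using (All; []; _∷_)
import Data.List.Relation.Unary.All.Properties as All
open import Data.List.Relation.Unary.Any using (here; there)
import Data.List.Relation.Unary.Any as Any
open import Data.List.Relation.Unary.AllPairs using ([]; _∷_)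
import Data.List.Relation.Unary.AllPairs as AllPairs
open import Data.List.Relation.Unary.Unique.Propositional using (Unique)
open import Data.List.Relation.Binary.Disjoint.Propositional using (Disjoint)
import Data.List.Relation.Unary.Unique.Propositional.Properties as Unique
open import Data.List.Membership.Propositional using () renaming (_∈_ to _∈ₗ_; _∉_ to _∉ₗ_)
open import Data.List.Membership.Propositional.Properties
  using (∈-map⁺; ∈-filter⁺; ∈-filter⁻; ∈-++⁺ˡ; ∈-++⁺ʳ; ∈-cartesianProductWith⁺)
import Data.List.Membership.DecPropositional as DecMembership
open import Function using (_∘_)
open import Data.Sum using (_⊎_; inj₁; inj₂)
open import Data.Product using (Σ; Σ-syntax; _×_; _,_; proj₁; proj₂)
open import Data.Empty using (⊥-elim)
open import Relation.Binary.PropositionalEquality using (_≡_; _≢_; refl; sym; trans; cong; cong₂; subst)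
open import Relation.Nullary using (¬_; ¬?; yes; no)
open import Relation.Nullary.Decidable using (⌊_⌋; dec-true; isYes≗does)
open import Data.Bool.Properties using (∧-zeroʳ)

private variable
  k : ℕ

fromList : List (Fin k) → Subset k
fromList = foldr (λ x p → ⁅ x ⁆ ∪ p) ⊥

∈-fromList⁺ : ∀ {x} {xs : List (Fin k)} → x ∈ₗ xs → x ∈ fromList xs
∈-fromList⁺ {x = x} (here refl) = x∈p∪q⁺ (inj₁ (x∈⁅x⁆ x))
∈-fromList⁺ (there x∈xs)        = x∈p∪q⁺ (inj₂ (∈-fromList⁺ x∈xs))

∣⁅x⁆∪p∣≤1+∣p∣ : ∀ (x : Fin k) p → ∣ ⁅ x ⁆ ∪ p ∣ ≤ suc ∣ p ∣
∣⁅x⁆∪p∣≤1+∣p∣ zero    (b ∷ p) rewrite ∪-identityˡ p = s≤s (∣p∣≤∣x∷p∣ b p)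
∣⁅x⁆∪p∣≤1+∣p∣ (suc x) (inside  ∷ p) = s≤s (∣⁅x⁆∪p∣≤1+∣p∣ x p)
∣⁅x⁆∪p∣≤1+∣p∣ (suc x) (outside ∷ p) = ∣⁅x⁆∪p∣≤1+∣p∣ x p

∣fromList∣≤length : (xs : List (Fin k)) → ∣ fromList xs ∣ ≤ length xs
∣fromList∣≤length {k} []  = ≤-reflexive (∣⊥∣≡0 k)
∣fromList∣≤length (x ∷ xs) = ≤-trans (∣⁅x⁆∪p∣≤1+∣p∣ x (fromList xs)) (s≤s (∣fromList∣≤length xs))

elements : Subset k → List (Fin k)
elements []            = []
elements (inside  ∷ p) = zero ∷ map suc (elements p)
elements (outside ∷ p) = map suc (elements p)

length-elements : (p : Subset k) → length (elements p) ≡ ∣ p ∣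
length-elements []            = refl
length-elements (inside  ∷ p) = cong suc (trans (length-map suc (elements p)) (length-elements p))
length-elements (outside ∷ p) = trans (length-map suc (elements p)) (length-elements p)

∈-elements⁺ : ∀ {x} {p : Subset k} → x ∈ p → x ∈ₗ elements p
∈-elements⁺ {p = inside  ∷ p} here       = here refl
∈-elements⁺ {p = inside  ∷ p} (there x∈p) = there (∈-map⁺ suc (∈-elements⁺ x∈p))
∈-elements⁺ {p = outside ∷ p} (there x∈p) = ∈-map⁺ suc (∈-elements⁺ x∈p)

elements⊆ : (p : Subset k) → All (_∈ p) (elements p)
elements⊆ []            = []
elements⊆ (inside  ∷ p) = here ∷ All.map⁺ (All.map there (elements⊆ p))
elements⊆ (outside ∷ p) = All.map⁺ (All.map there (elements⊆ p))

elements-unique : (p : Subset k) → Unique (elements p)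
elements-unique []            = []
elements-unique (inside  ∷ p) =
  All.map⁺ (All.universal (λ _ ()) (elements p)) ∷ Unique.map⁺ suc-injective (elements-unique p)
elements-unique (outside ∷ p) = Unique.map⁺ suc-injective (elements-unique p)

length≤∣p∣ : ∀ {xs : List (Fin k)} {p} → Unique xs → All (_∈ p) xs → length xs ≤ ∣ p ∣
length≤∣p∣ {xs = []}     _              _           = z≤n
length≤∣p∣ {xs = x ∷ xs} (x∉xs ∷ xs!) (x∈p ∷ xs⊆p) =
  ≤-trans (s≤s (length≤∣p∣ xs! (All.zipWith (λ (y∈p , x≢y) → x∈p∧x≢y⇒x∈p-y y∈p (x≢y ∘ sym)) (xs⊆p , x∉xs))))
          (x∈p⇒∣p-x∣<∣p∣ x∈p)

infixl 5 _∖_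
_∖_ : List (Fin k) → Fin k → List (Fin k)
xs ∖ g = filter (λ y → ¬? (y ≟ g)) xs

length≤1+length-∖ : ∀ {xs : List (Fin k)} g → Unique xs → length xs ≤ suc (length (xs ∖ g))
length≤1+length-∖ {xs = []}     g _ = z≤n
length≤1+length-∖ {xs = x ∷ xs} g (x∉xs ∷ xs!) with x ≟ g
... | yes refl = s≤s (≤-reflexive (cong length (sym (filter-all (λ y → ¬? (y ≟ x)) (All.map (_∘ sym) x∉xs)))))
... | no _     = s≤s (length≤1+length-∖ g xs!)

length-∖< : ∀ {g} {xs : List (Fin k)} → g ∈ₗ xs → length (xs ∖ g) < length xs
length-∖< {xs = xs} g∈xs = filter-notAll _ xs (Any.map (λ g≡y y≢g → y≢g (sym g≡y)) g∈xs)

length-cartesianProductWith : ∀ {A B C : Set} (f : A → B → C) xs ys →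
  length (cartesianProductWith f xs ys) ≡ length xs * length ys
length-cartesianProductWith f []       ys = refl
length-cartesianProductWith f (x ∷ xs) ys =
  trans (length-++ (map (f x) ys)) (cong₂ _+_ (length-map (f x) ys) (length-cartesianProductWith f xs ys))

Adj-sym : ∀ G {u v} → Adj G u v → Adj G v u
Adj-sym G {u} {v} u~v = trans (adj-sym G v u) u~v

Adj⇒≢ : ∀ G {u v} → Adj G u v → u ≢ v
Adj⇒≢ G {u} u~u refl with () ← trans (sym u~u) (irref G u)

record Quorum (G : Graph) (t : ℕ) (P : Fin (n G) → Set) (v : Fin (n G)) : Set where
  constructor quorum
  field
    members  : List (Fin (n G))
    unique   : Unique members
    enough   : t ≤ length members
    adjacent : All (Adj G v) members
    satisfy  : All P members

activate : ∀ {G t D v} → Quorum G t (Active G t D) v → Active G t D v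
activate (quorum us us! t≤us v~us act) = step us us! t≤us v~us act

Quorum-irrefl : ∀ {G t P v} → Quorum G t P v → Quorum G t (λ u → u ≢ v × P u) v
Quorum-irrefl {G} (quorum us us! t≤us v~us Pus) =
  quorum us us! t≤us v~us (All.zipWith (λ (v~u , Pu) → Adj⇒≢ G v~u ∘ sym , Pu) (v~us , Pus))

Quorum-∖ : ∀ {G t P v} g → Quorum G (suc t) P v → Quorum G t (λ u → u ≢ g × P u) v
Quorum-∖ g (quorum us us! t≤us v~us Pus) =
  quorum (us ∖ g) (Unique.filter⁺ _ us!) (s≤s⁻¹ (≤-trans t≤us (length≤1+length-∖ g us!)))
         (All.filter⁺ _ v~us) (All.zip (All.all-filter _ us , All.filter⁺ _ Pus))

Quorum-∷ : ∀ {G t P v u} → Adj G v u → P u → Quorum G t (λ y → y ≢ u × P y) v → Quorum G (suc t) P v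
Quorum-∷ v~u Pu (quorum us us! t≤us v~us Pus) =
  quorum (_ ∷ us) (All.map (λ (y≢u , _) → y≢u ∘ sym) Pus ∷ us!) (s≤s t≤us) (v~u ∷ v~us) (Pu ∷ All.map proj₂ Pus)

∈-nbhd⇒Adj : ∀ G {v u} → u ∈ nbhd G v → Adj G v u
∈-nbhd⇒Adj G {v} {u} u∈N = trans (sym (lookup∘tabulate (adj G v) u)) ([]=⇒lookup u∈N)

Quorum-nbhd : ∀ {G t P v} → ThresholdOK G t → (∀ {u} → Adj G v u → P u) → Quorum G t P v
Quorum-nbhd {G = G} {v = v} t≤deg v~⇒P =
  quorum (elements N) (elements-unique N) (subst (_ ≤_) (sym (length-elements N)) (t≤deg v))
         v~Ns (All.map v~⇒P v~Ns)
  where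
  N : Subset (n G)
  N = nbhd G v
  v~Ns : All (Adj G v) (elements N)
  v~Ns = All.map (∈-nbhd⇒Adj G) (elements⊆ N)

Quorum⇒t≤∣D∣ : ∀ {G t D v} → Quorum G t (_∈ D) v → t ≤ ∣ D ∣
Quorum⇒t≤∣D∣ (quorum us us! t≤us _ us⊆D) = ≤-trans t≤us (length≤∣p∣ us! us⊆D)

record Embedding (A B : Graph) : Set where
  field
    embed     : Fin (n A) → Fin (n B)
    injective : ∀ {x y} → embed x ≡ embed y → x ≡ y
    preserves : ∀ {x y} → Adj A x y → Adj B (embed x) (embed y)
open Embedding

idEmbedding : ∀ {G} → Embedding G G
idEmbedding {G = G} = record { embed = λ x → x ; injective = λ eq → eq ; preserves = λ a → a }

Quorum-map : ∀ {A B t} (e : Embedding A B) {P Q} → (∀ {x} → P x → Q (embed e x)) →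
             ∀ {v} → Quorum A t P v → Quorum B t Q (embed e v)
Quorum-map e P⇒Q (quorum us us! t≤us v~us Pus) =
  quorum (map (embed e) us) (Unique.map⁺ (injective e) us!) (subst (_ ≤_) (sym (length-map _ us)) t≤us)
         (All.map⁺ (All.map (preserves e) v~us)) (All.map⁺ (All.map P⇒Q Pus))

Quorum-weaken : ∀ {G t P Q v} → (∀ {x} → P x → Q x) → Quorum G t P v → Quorum G t Q v
Quorum-weaken {G} P⇒Q = Quorum-map (idEmbedding {G}) P⇒Q

module _ {A B : Graph} {t : ℕ} (e : Embedding A B) {DA : Subset (n A)} {DB : Subset (n B)}
         (seeds : ∀ {x} → x ∈ DA → Active B t DB (embed e x)) where

  Active-map : ∀ {x} → Active A t DA x → Active B t DB (embed e x)
  Active-map* : ∀ {xs} → All (Active A t DA) xs → All (λ x → Active B t DB (embed e x)) xs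

  Active-map (seed x∈DA) = seeds x∈DA
  Active-map (step us us! t≤us v~us act) =
    activate {t = t} (Quorum-map e {P = Active B t DB ∘ embed e} (λ a → a)
                                   (quorum us us! t≤us v~us (Active-map* act)))
  Active-map* []         = []
  Active-map* (a ∷ acts) = Active-map a ∷ Active-map* acts

module _ {G : Graph} {t : ℕ} {D : Subset (n G)} where

  first-quorum : ∀ {x} → Active G t D x → x ∉ D → Σ[ v ∈ Fin (n G) ] Quorum G t (_∈ D) v
  first-quorum* : ∀ {us} → All (Active G t D) us →
                  (All (_∈ D) us → Σ[ v ∈ Fin (n G) ] Quorum G t (_∈ D) v) →
                  Σ[ v ∈ Fin (n G) ] Quorum G t (_∈ D) v

  first-quorum (seed x∈D)                      x∉D = ⊥-elim (x∉D x∈D)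
  first-quorum {x} (step us us! t≤us x~us act) _   =
    first-quorum* act (λ us⊆D → x , quorum us us! t≤us x~us us⊆D)
  first-quorum* []                  k = k []
  first-quorum* {u ∷ _} (a ∷ acts) k with u ∈ₛ? D
  ... | yes u∈D = first-quorum* acts (k ∘ (u∈D ∷_))
  ... | no  u∉D = first-quorum a u∉D

  dynamo-quorum : ThresholdOK G t → IsDynMono G t D → Fin (n G) → Σ[ v ∈ Fin (n G) ] Quorum G t (_∈ D) v
  dynamo-quorum t≤deg dyn x with all? (_∈ₛ? D)
  ... | yes all∈D = x , Quorum-nbhd t≤deg (λ {u} _ → all∈D u)
  ... | no ¬all∈D with y , y∉D ← ¬∀⟶∃¬ (n G) (_∈ D) (_∈ₛ? D) ¬all∈D = first-quorum (dyn y) y∉D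

  minimum-dynamo⇒¬Quorum : IsMinDynMono G t D → ∀ {v} → v ∈ D → ¬ Quorum G t (_∈ D) v
  minimum-dynamo⇒¬Quorum (dyn , minimum) {v} v∈D q =
    <⇒≱ (x∈p⇒∣p-x∣<∣p∣ v∈D) (minimum (D - v) dyn-v)
    where
    seeds : ∀ {x} → x ∈ D → Active G t (D - v) x
    seeds {x} x∈D with x ≟ v
    ... | yes refl = activate (Quorum-weaken (λ (u≢v , u∈D) → seed (x∈p∧x≢y⇒x∈p-y u∈D u≢v)) (Quorum-irrefl q))
    ... | no  x≢v  = seed (x∈p∧x≢y⇒x∈p-y x∈D x≢v)
    dyn-v : IsDynMono G t (D - v)
    dyn-v x = Active-map idEmbedding seeds (dyn x)

module _ (G H : Graph) where

  □-adj-combine : ∀ g h g′ h′ → adj (G □ H) (combine g h) (combine g′ h′) ≡ □-padj G H (g , h) (g′ , h′)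
  □-adj-combine g h g′ h′ = cong₂ (□-padj G H) (remQuot-combine g h) (remQuot-combine g′ h′)

  row : Fin (n H) → Embedding G (G □ H)
  row h = record
    { embed     = λ g → combine g h
    ; injective = λ {g} {g′} eq → proj₁ (combine-injective g h g′ h eq)
    ; preserves = λ {g} {g′} g~g′ → trans (□-adj-combine g h g′ h) (row-adj g g′ g~g′)
    }
    where
    row-adj : ∀ g g′ → Adj G g g′ → (⌊ g ≟ g′ ⌋ ∧ adj H h h) ∨ (⌊ h ≟ h ⌋ ∧ adj G g g′) ≡ true
    row-adj g g′ g~g′ rewrite irref H h | isYes≗does (h ≟ h) | dec-true (h ≟ h) refl | ∧-zeroʳ ⌊ g ≟ g′ ⌋ = g~g′

  column : Fin (n G) → Embedding H (G □ H)
  column g = record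
    { embed     = combine g
    ; injective = λ {h} {h′} eq → proj₂ (combine-injective g h g h′ eq)
    ; preserves = λ {h} {h′} h~h′ → trans (□-adj-combine g h g h′) (column-adj h h′ h~h′)
    }
    where
    column-adj : ∀ h h′ → Adj H h h′ → (⌊ g ≟ g ⌋ ∧ adj H h h′) ∨ (⌊ h ≟ h′ ⌋ ∧ adj G g g) ≡ true
    column-adj h h′ h~h′ rewrite isYes≗does (g ≟ g) | dec-true (g ≟ g) refl | h~h′ = refl

activate-∷ : ∀ {A B t D} (e : Embedding A B) {x u} → Adj B (embed e x) u → Active B (suc t) D u →
             (∀ z → embed e z ≢ u) → Quorum A t (λ z → Active B (suc t) D (embed e z)) x →
             Active B (suc t) D (embed e x)
activate-∷ e x~u u-active off q = activate (Quorum-∷ x~u u-active (Quorum-map e (λ {z} a → off z , a) q))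

IsUniversalIn : (H : Graph) → Subset (n H) → Fin (n H) → Set
IsUniversalIn H D c = c ∈ D × (∀ {y} → y ∈ D → y ≢ c → Adj H c y)

InducedIsoStar⇒universal : ∀ {H D m} → InducedIsoStar H D m → Σ[ c ∈ Fin (n H) ] IsUniversalIn H D c
InducedIsoStar⇒universal {H} {D} (f , _ , f∈D , onto , f-adj) = f zero , f∈D zero , centre-adj
  where
  centre-adj : ∀ {y} → y ∈ D → y ≢ f zero → Adj H (f zero) y
  centre-adj y∈D y≢c with onto _ y∈D
  ... | zero  , refl = ⊥-elim (y≢c refl)
  ... | suc i , refl = f-adj zero (suc i)

record Leaves (H : Graph) (D : Subset (n H)) (c : Fin (n H)) (t : ℕ) : Set where
  field
    leaves   : List (Fin (n H))
    unique   : Unique leaves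
    adjacent : All (Adj H c) leaves
    covers   : ∀ {h} → h ∈ D → h ∈ₗ c ∷ leaves
    size     : length leaves ≡ t
    ∣D∣≡1+t  : ∣ D ∣ ≡ suc t

universal⇒Leaves : ∀ {H t D c} → ThresholdOK H (suc t) → IsMinDynMono H (suc t) D → IsUniversalIn H D c →
                   Leaves H D c t
universal⇒Leaves {H} {t} {D} {c} t≤deg minD (c∈D , c~D) = record
  { leaves = ls ; unique = ls! ; adjacent = c~ls ; covers = covers
  ; size = ≤-antisym ls≤t t≤ls ; ∣D∣≡1+t = ≤-antisym (≤-trans ∣D∣≤1+ls (s≤s ls≤t)) 1+t≤∣D∣ }
  where
  ls : List (Fin (n H))
  ls = elements D ∖ c
  ls! : Unique ls
  ls! = Unique.filter⁺ _ (elements-unique D)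
  c~ls : All (Adj H c) ls
  c~ls = All.zipWith (λ (y∈D , y≢c) → c~D y∈D y≢c)
                     (All.filter⁺ _ (elements⊆ D) , All.all-filter _ (elements D))
  covers : ∀ {h} → h ∈ D → h ∈ₗ c ∷ ls
  covers {h} h∈D with h ≟ c
  ... | yes refl = here refl
  ... | no  h≢c  = there (∈-filter⁺ _ (∈-elements⁺ h∈D) h≢c)
  ls≤t : length ls ≤ t
  ls≤t = ≮⇒≥ λ t<ls →
    minimum-dynamo⇒¬Quorum minD c∈D (quorum ls ls! t<ls c~ls (All.filter⁺ _ (elements⊆ D)))
  1+t≤∣D∣ : suc t ≤ ∣ D ∣
  1+t≤∣D∣ = Quorum⇒t≤∣D∣ (proj₂ (dynamo-quorum t≤deg (proj₁ minD) c))
  ∣D∣≤1+ls : ∣ D ∣ ≤ suc (length ls)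
  ∣D∣≤1+ls = subst (_≤ suc (length ls)) (length-elements D) (length≤1+length-∖ c (elements-unique D))
  t≤ls : t ≤ length ls
  t≤ls = s≤s⁻¹ (≤-trans 1+t≤∣D∣ ∣D∣≤1+ls)

module Seeding {G H : Graph} {t : ℕ} {DG : Subset (n G)} (dyn-G : IsDynMono G (suc t) DG)
               (t≤deg : ThresholdOK G (suc t)) {w : Fin (n G)} (trigger : Quorum G (suc t) (_∈ DG) w)
               {g₁ : Fin (n G)} (g₁∈DG : g₁ ∈ DG) {c ℓ₀ ℓ₁ : Fin (n H)} {others : List (Fin (n H))}
               (leaves! : Unique (ℓ₀ ∷ ℓ₁ ∷ others)) (c~leaves : All (Adj H c) (ℓ₀ ∷ ℓ₁ ∷ others))
               (size : length (ℓ₀ ∷ ℓ₁ ∷ others) ≡ t) where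

  open Quorum trigger using ()
    renaming (members to us; unique to us!; enough to 1+t≤us; adjacent to w~us; satisfy to us⊆DG)
  open DecMembership (_≟_ {n G}) using () renaming (_∈?_ to _∈ₗ?_)

  leaves : List (Fin (n H))
  leaves = ℓ₀ ∷ ℓ₁ ∷ others

  Γ : Graph
  Γ = G □ H

  infix 6 _⊗_
  _⊗_ : Fin (n G) → Fin (n H) → Fin (n Γ)
  _⊗_ = combine

  ⊗-injective : ∀ {x h y k} → x ⊗ h ≡ y ⊗ k → x ≡ y × h ≡ k
  ⊗-injective = combine-injective _ _ _ _

  grid : List (Fin (n Γ))
  grid = cartesianProductWith _⊗_ (elements DG) leaves

  off-trigger : List (Fin (n G))
  off-trigger = filter (λ x → ¬? (x ∈ₗ? us)) (elements DG)

  seeds : List (Fin (n Γ))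
  seeds = w ⊗ c ∷ (grid ∖ g₁ ⊗ ℓ₀) ++ map (_⊗ c) off-trigger

  Active□ : Fin (n Γ) → Set
  Active□ = Active Γ (suc t) (fromList seeds)

  seeded : ∀ {y} → y ∈ₗ seeds → Active□ y
  seeded y∈seeds = seed (∈-fromList⁺ y∈seeds)

  grid-seeded : ∀ {x h} → x ∈ DG → h ∈ₗ leaves → x ⊗ h ≢ g₁ ⊗ ℓ₀ → Active□ (x ⊗ h)
  grid-seeded x∈DG h∈leaves ≢g₁⊗ℓ₀ =
    seeded (there (∈-++⁺ˡ (∈-filter⁺ _ (∈-cartesianProductWith⁺ _⊗_ (∈-elements⁺ x∈DG) h∈leaves) ≢g₁⊗ℓ₀)))

  off-trigger-seeded : ∀ {x} → x ∈ DG → x ∉ₗ us → Active□ (x ⊗ c)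
  off-trigger-seeded x∈DG x∉us = seeded (there (∈-++⁺ʳ _ (∈-map⁺ (_⊗ c) (∈-filter⁺ _ (∈-elements⁺ x∈DG) x∉us))))

  c≢leaf : ∀ {h} → h ∈ₗ leaves → c ≢ h
  c≢leaf h∈leaves = Adj⇒≢ H (All.lookup c~leaves h∈leaves)

  ℓ₁≢ℓ₀ : ℓ₁ ≢ ℓ₀
  ℓ₁≢ℓ₀ = All.head (AllPairs.head leaves!) ∘ sym

  ℓ₁∈leaves : ℓ₁ ∈ₗ leaves
  ℓ₁∈leaves = there (here refl)

  leaf-row : ∀ {h} → h ∈ₗ leaves → h ≢ ℓ₀ → ∀ x → Active□ (x ⊗ h)
  leaf-row h∈leaves h≢ℓ₀ x =
    Active-map (row G H _) (λ x∈DG → grid-seeded x∈DG h∈leaves (h≢ℓ₀ ∘ proj₂ ∘ ⊗-injective)) (dyn-G x)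

  centre-of-seed : ∀ {x} → x ∈ DG → x ≢ g₁ → Active□ (x ⊗ c)
  centre-of-seed {x} x∈DG x≢g₁ with x ∈ₗ? us
  ... | no  x∉us = off-trigger-seeded x∈DG x∉us
  ... | yes x∈us = activate-∷ (column G H x) (preserves (row G H c) x~w) (seeded (here refl))
                     (λ _ → Adj⇒≢ G x~w ∘ proj₁ ∘ ⊗-injective) leaf-column
    where
    x~w : Adj G x w
    x~w = Adj-sym G (All.lookup w~us x∈us)
    leaf-column : Quorum H t (λ h → Active□ (x ⊗ h)) c
    leaf-column = Quorum-weaken (λ h∈leaves → grid-seeded x∈DG h∈leaves (x≢g₁ ∘ proj₁ ∘ ⊗-injective))
                    (quorum leaves leaves! (≤-reflexive (sym size)) c~leaves (All.tabulate (λ h∈ → h∈)))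

  Active-c-ℓ₀ : Fin (n G) → Set
  Active-c-ℓ₀ x = Active□ (x ⊗ c) × Active□ (x ⊗ ℓ₀)

  -- Replaying the activation of x in the rows c and ℓ₀, x may lose the neighbour g₁ but gains the
  -- neighbour (x , ℓ₁) resp. (x , c) from the adjacent row.
  off-g₁ : ∀ {x} → Active G (suc t) DG x → x ≢ g₁ → Active-c-ℓ₀ x
  off-g₁* : ∀ {xs} → All (Active G (suc t) DG) xs → All (λ u → u ≢ g₁ → Active-c-ℓ₀ u) xs

  off-g₁ (seed x∈DG) x≢g₁ = centre-of-seed x∈DG x≢g₁ , grid-seeded x∈DG (here refl) (x≢g₁ ∘ proj₁ ∘ ⊗-injective)
  off-g₁ {x} (step vs vs! 1+t≤vs x~vs act) _ = centre , leaf₀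
    where
    nbrs : Quorum G t Active-c-ℓ₀ x
    nbrs = Quorum-weaken (λ (u≢g₁ , ih) → ih u≢g₁) (Quorum-∖ g₁ (quorum vs vs! 1+t≤vs x~vs (off-g₁* act)))
    centre : Active□ (x ⊗ c)
    centre = activate-∷ (row G H c) (preserves (column G H x) (All.lookup c~leaves ℓ₁∈leaves))
               (leaf-row ℓ₁∈leaves ℓ₁≢ℓ₀ x) (λ _ → c≢leaf ℓ₁∈leaves ∘ proj₂ ∘ ⊗-injective)
               (Quorum-weaken proj₁ nbrs)
    leaf₀ : Active□ (x ⊗ ℓ₀)
    leaf₀ = activate-∷ (row G H ℓ₀) (preserves (column G H x) (Adj-sym H (All.head c~leaves)))
              centre (λ _ → c≢leaf (here refl) ∘ sym ∘ proj₂ ∘ ⊗-injective) (Quorum-weaken proj₂ nbrs)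
  off-g₁* []         = []
  off-g₁* (a ∷ acts) = off-g₁ a ∷ off-g₁* acts

  centre-and-leaf₀ : ∀ x → Active-c-ℓ₀ x
  centre-and-leaf₀ x with x ≟ g₁
  ... | no  x≢g₁ = off-g₁ (dyn-G x) x≢g₁
  ... | yes refl = activate (Quorum-map (row G H c) proj₁ around-g₁)
                 , activate (Quorum-map (row G H ℓ₀) proj₂ around-g₁)
    where
    around-g₁ : Quorum G (suc t) Active-c-ℓ₀ g₁
    around-g₁ = Quorum-weaken (λ (u≢g₁ , u-active) → off-g₁ u-active u≢g₁)
                  (Quorum-irrefl (Quorum-nbhd t≤deg (λ {u} _ → dyn-G u)))

  rows-active : ∀ x {h} → h ∈ₗ c ∷ leaves → Active□ (x ⊗ h)
  rows-active x (here refl) = proj₁ (centre-and-leaf₀ x)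
  rows-active x {h} (there h∈leaves) with h ≟ ℓ₀
  ... | yes refl = proj₂ (centre-and-leaf₀ x)
  ... | no  h≢ℓ₀ = leaf-row h∈leaves h≢ℓ₀ x

  seeds-dynamo : ∀ {DH} → IsDynMono H (suc t) DH → (∀ {h} → h ∈ DH → h ∈ₗ c ∷ leaves) →
                 IsDynMono Γ (suc t) (fromList seeds)
  seeds-dynamo dyn-H covers y =
    subst Active□ (combine-remQuot {n G} (n H) y) (Active-map (column G H x) (rows-active x ∘ covers) (dyn-H h))
    where
    x : Fin (n G)
    x = proj₁ (remQuot {n G} (n H) y)
    h : Fin (n H)
    h = proj₂ (remQuot {n G} (n H) y)

  off-trigger+1+t≤∣DG∣ : length off-trigger + suc t ≤ ∣ DG ∣
  off-trigger+1+t≤∣DG∣ = begin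
    length off-trigger + suc t      ≤⟨ +-monoʳ-≤ (length off-trigger) 1+t≤us ⟩
    length off-trigger + length us  ≡⟨ +-comm (length off-trigger) (length us) ⟩
    length us + length off-trigger  ≡⟨ length-++ us ⟨
    length (us ++ off-trigger)      ≤⟨ length≤∣p∣ us++off! (All.++⁺ us⊆DG (All.filter⁺ _ (elements⊆ DG))) ⟩
    ∣ DG ∣                          ∎
    where
    open ≤-Reasoning
    disjoint : Disjoint us off-trigger
    disjoint (v∈us , v∈off) = proj₂ (∈-filter⁻ (λ x → ¬? (x ∈ₗ? us)) {xs = elements DG} v∈off) v∈us
    us++off! : Unique (us ++ off-trigger)
    us++off! = Unique.++⁺ us! (Unique.filter⁺ _ (elements-unique DG)) disjoint

  grid∖g₁⊗ℓ₀<∣DG∣*t : length (grid ∖ g₁ ⊗ ℓ₀) < ∣ DG ∣ * t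
  grid∖g₁⊗ℓ₀<∣DG∣*t = begin-strict
    length (grid ∖ g₁ ⊗ ℓ₀)               <⟨ length-∖< g₁⊗ℓ₀∈grid ⟩
    length grid                           ≡⟨ length-cartesianProductWith _⊗_ (elements DG) leaves ⟩
    length (elements DG) * length leaves  ≡⟨ cong₂ _*_ (length-elements DG) size ⟩
    ∣ DG ∣ * t                            ∎
    where
    open ≤-Reasoning
    g₁⊗ℓ₀∈grid : g₁ ⊗ ℓ₀ ∈ₗ grid
    g₁⊗ℓ₀∈grid = ∈-cartesianProductWith⁺ _⊗_ (∈-elements⁺ g₁∈DG) (here refl)

  length-seeds : length seeds ≤ ∣ DG ∣ * suc t ∸ suc t
  length-seeds = m+n≤o⇒m≤o∸n (length seeds) (begin
    length seeds + suc t                       ≡⟨ cong (λ m → suc m + suc t) length-parts ⟩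
    suc (length (grid ∖ g₁ ⊗ ℓ₀) + length off-trigger) + suc t
                                               ≡⟨ cong suc (+-assoc (length (grid ∖ g₁ ⊗ ℓ₀)) _ _) ⟩
    suc (length (grid ∖ g₁ ⊗ ℓ₀)) + (length off-trigger + suc t)
                                               ≤⟨ +-mono-≤ grid∖g₁⊗ℓ₀<∣DG∣*t off-trigger+1+t≤∣DG∣ ⟩
    ∣ DG ∣ * t + ∣ DG ∣                        ≡⟨ +-comm (∣ DG ∣ * t) _ ⟩
    ∣ DG ∣ + ∣ DG ∣ * t                        ≡⟨ *-suc ∣ DG ∣ t ⟨
    ∣ DG ∣ * suc t                             ∎)
    where
    open ≤-Reasoning
    length-parts : length ((grid ∖ g₁ ⊗ ℓ₀) ++ map (_⊗ c) off-trigger)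
                   ≡ length (grid ∖ g₁ ⊗ ℓ₀) + length off-trigger
    length-parts = trans (length-++ (grid ∖ g₁ ⊗ ℓ₀))
                         (cong (length (grid ∖ g₁ ⊗ ℓ₀) +_) (length-map (_⊗ c) off-trigger))

Fin⊎≡0 : ∀ m → Fin m ⊎ m ≡ 0
Fin⊎≡0 zero    = inj₂ refl
Fin⊎≡0 (suc m) = inj₁ zero

□-dynamo-bound : ∀ {G H t DG DH c} → 3 ≤ t → ThresholdOK G t → ThresholdOK H t →
                 IsDynMono G t DG → IsMinDynMono H t DH → IsUniversalIn H DH c →
                 Σ[ S ∈ Subset (n (G □ H)) ] IsDynMono (G □ H) t S × ∣ S ∣ ≤ ∣ DG ∣ * ∣ DH ∣ ∸ ∣ DH ∣
□-dynamo-bound {G} {H} {suc t} {DG} {DH} (s≤s (s≤s (s≤s _))) t≤degG t≤degH dyn-G min-H universal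
  with Fin⊎≡0 (n G) | universal⇒Leaves t≤degH min-H universal
... | inj₂ nG≡0 | _ = ⊥ , (λ y → ⊥-elim (¬Fin0 (subst Fin nG≡0 (proj₁ (remQuot {n G} (n H) y))))) , ∣⊥∣≤
  where
  ∣⊥∣≤ : ∣ ⊥ {n (G □ H)} ∣ ≤ ∣ DG ∣ * ∣ DH ∣ ∸ ∣ DH ∣
  ∣⊥∣≤ rewrite ∣⊥∣≡0 (n (G □ H)) = z≤n
... | inj₁ x | record { leaves = ℓ₀ ∷ ℓ₁ ∷ others ; unique = leaves! ; adjacent = c~leaves
                      ; covers = covers ; size = size ; ∣D∣≡1+t = ∣DH∣≡1+t }
  with dynamo-quorum t≤degG dyn-G x
... | w , trigger@(quorum (g₁ ∷ _) _ _ _ (g₁∈DG ∷ _)) =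
  fromList seeds , seeds-dynamo (proj₁ min-H) covers , ∣S∣≤
  where
  open Seeding {H = H} dyn-G t≤degG trigger g₁∈DG leaves! c~leaves size
  ∣S∣≤ : ∣ fromList seeds ∣ ≤ ∣ DG ∣ * ∣ DH ∣ ∸ ∣ DH ∣
  ∣S∣≤ rewrite ∣DH∣≡1+t = ≤-trans (∣fromList∣≤length seeds) length-seeds

corollary1 : (G H : Graph) (t : ℕ) → 3 ≤ t →
    ThresholdOK G t → ThresholdOK H t →
    (DG : Subset (n G)) → IsMinDynMono G t DG →
    (DH : Subset (n H)) → IsMinDynMono H t DH →
    InducedIsoStar H DH (∣ DH ∣ ∸ 1) →
    Σ (Subset (n (G □ H))) λ D →
      IsDynMono (G □ H) t D × ∣ D ∣ ≤ ∣ DG ∣ * ∣ DH ∣ ∸ ∣ DH ∣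
corollary1 G H t 3≤t t≤degG t≤degH DG (dyn-G , _) DH min-H star =
  □-dynamo-bound {G} {H} 3≤t t≤degG t≤degH dyn-G min-H (proj₂ (InducedIsoStar⇒universal {H} star))
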